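{- Let $D(\mathbf x)\in\mathbb F^k[x_1,\dots,x_n]$ have a cone-closed basis. Then $D$ is $(k+1)$-cone concentrated and $(\lg 2k)$-support concentrated.
   Context: Throughout, $\mathbb F=\mathbb Q$. $D\in\mathbb F^k[\mathbf x]$ is a polynomial whose coefficients $\mathrm{coef}_{\mathbf x^{\mathbf e}}(D)$ lie in $\mathbb F^k$; $\mathrm{lrsp}(D)$ is their linear span. A monomial $\mathbf x^{\mathbf e}$ is a submonomial of $\mathbf x^{\mathbf f}$ if $\mathbf e\le\mathbf f$ coordinatewise; its cone-size is $\prod_i(e_i+1)$ and its support size is the number of $i$ with $e_i>0$. A set of monomials is cone-closed if it contains all submonomials of its members. $D$ has a cone-closed basis if some cone-closed set of monomials has coefficients forming a basis of $\mathrm{lrsp}(D)$. $D$ is $\ell$-cone concentrated (resp. $\ell$-support concentrated) if the coefficients of the monomials of cone-size $<\ell$ (resp. support size $<\ell$) span $\mathrm{lrsp}(D)$. $\lg=\log_2$. -}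

module Defs where

open import Data.Nat as ℕ using (ℕ; zero; suc; _<_; _≤_)
open import Data.Rational as ℚ using (ℚ; 0ℚ)
open import Data.Vec as V using (Vec; []; _∷_)
open import Data.Vec.Properties using (≡-dec)
open import Data.Vec.Relation.Binary.Pointwise.Inductive using (Pointwise)
open import Data.List as L using (List; length)
open import Data.List.Relation.Unary.All using (All)
open import Data.List.Membership.Propositional using (_∈_)
open import Data.Product using (Σ; _×_; _,_)
open import Data.Unit using (⊤)
open import Relation.Nullary using (yes; no)
open import Relation.Binary.PropositionalEquality using (_≡_)

Monomial : ℕ → Set
Monomial n = Vec ℕ n

Vecℚ : ℕ → Set
Vecℚ k = Vec ℚ k

zeroV : ∀ {k} → Vecℚ k
zeroV {k} = V.replicate k 0ℚ

_+V_ : ∀ {k} → Vecℚ k → Vecℚ k → Vecℚ k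
_+V_ = V.zipWith ℚ._+_

_·V_ : ∀ {k} → ℚ → Vecℚ k → Vecℚ k
c ·V v = V.map (c ℚ.*_) v

-- A polynomial D ∈ F^k[x_1..x_n], given as a finite list of terms
-- (exponent vector, coefficient in F^k); repeated monomials are added.
Poly : ℕ → ℕ → Set
Poly n k = List (Monomial n × Vecℚ k)

coef : ∀ {n k} → Poly n k → Monomial n → Vecℚ k
coef L.[] e = zeroV
coef ((f , c) L.∷ D) e with ≡-dec ℕ._≟_ e f
... | yes _ = c +V coef D e
... | no  _ = coef D e

lincomb : ∀ {k} (vs : List (Vecℚ k)) → Vec ℚ (length vs) → Vecℚ k
lincomb L.[] [] = zeroV
lincomb (v L.∷ vs) (c ∷ cs) = (c ·V v) +V lincomb vs cs

InSpan : ∀ {k} → List (Vecℚ k) → Vecℚ k → Set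
InSpan vs v = Σ (Vec ℚ (length vs)) λ cs → lincomb vs cs ≡ v

LinIndep : ∀ {k} → List (Vecℚ k) → Set
LinIndep vs = ∀ cs → lincomb vs cs ≡ zeroV → cs ≡ V.replicate (length vs) 0ℚ

coefs : ∀ {n k} → Poly n k → List (Monomial n) → List (Vecℚ k)
coefs D ms = L.map (coef D) ms

SpanOfMons : ∀ {n k} → Poly n k → (Monomial n → Set) → Vecℚ k → Set
SpanOfMons {n} D P v = Σ (List (Monomial n)) λ ms → All P ms × InSpan (coefs D ms) v

lrsp : ∀ {n k} → Poly n k → Vecℚ k → Set
lrsp D = SpanOfMons D (λ _ → ⊤)

_≼_ : ∀ {n} → Monomial n → Monomial n → Set
e ≼ f = Pointwise _≤_ e f

ConeClosed : ∀ {n} → List (Monomial n) → Set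
ConeClosed {n} S = ∀ (f e : Monomial n) → f ∈ S → e ≼ f → e ∈ S

HasConeClosedBasis : ∀ {n k} → Poly n k → Set
HasConeClosedBasis {n} D =
  Σ (List (Monomial n)) λ S →
    ConeClosed S × LinIndep (coefs D S) × (∀ v → lrsp D v → InSpan (coefs D S) v)

coneSize : ∀ {n} → Monomial n → ℕ
coneSize e = V.foldr _ (λ a r → suc a ℕ.* r) 1 e

supportSize : ∀ {n} → Monomial n → ℕ
supportSize [] = 0
supportSize (zero ∷ e) = supportSize e
supportSize (suc _ ∷ e) = suc (supportSize e)

ConeConcentrated : ∀ {n k} → ℕ → Poly n k → Set
ConeConcentrated ℓ D = ∀ v → lrsp D v → SpanOfMons D (λ e → coneSize e < ℓ) v

-- (lg 2k)-support concentrated: support size s < lg(2k) ⇔ 2^s < 2k (s ∈ ℕ)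
LgSupportConcentrated : ∀ {n k} → Poly n k → Set
LgSupportConcentrated {k = k} D =
  ∀ v → lrsp D v → SpanOfMons D (λ e → 2 ℕ.^ supportSize e < 2 ℕ.* k) v

-- The coefficients of a cone-closed basis S are linearly independent in ℚ^k, so |S| ≤ k.
-- Cone-closedness puts the whole cone of every e ∈ S inside S, and the cone of e has
-- coneSize e elements; hence coneSize e ≤ k.  Each variable occurring in e at least
-- doubles the cone, so 2^(supportSize e) ≤ coneSize e ≤ k < 2k.
module Submission where

open import Defs
open import Algebra.Bundles using (CommutativeRing)
open import Data.Nat as ℕ using (ℕ; zero; suc; z≤n; s≤s)
import Data.Nat.Properties as ℕP
open import Data.Rational as ℚ using (ℚ; 0ℚ; 1ℚ; _+_; _*_; -_; _-_; 1/_)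
import Data.Rational.Properties as ℚP
open import Data.Rational.Solver using (module +-*-Solver)
open import Data.Fin as Fin using (Fin; toℕ; punchIn; remQuot; combine)
import Data.Fin.Properties as FinP
open import Data.Vec as Vec using ([]; _∷_; lookup; tabulate)
import Data.Vec.Properties as VecP
open import Data.Vec.Functional using (insertAt)
open import Data.Vec.Functional.Properties using (insertAt-lookup; insertAt-punchIn)
open import Data.Vec.Relation.Binary.Pointwise.Inductive using ([]; _∷_)
open import Data.List as List using (List; length)
import Data.List.Properties as ListP
import Data.List.Relation.Unary.All as All
import Data.List.Relation.Unary.Any as Any
open import Data.List.Relation.Unary.Any.Properties using (lookup-index)
open import Data.List.Membership.Propositional using (_∈_)
open import Data.Product using (_×_; _,_; proj₁; proj₂)
open import Data.Product.Properties using (×-≡,≡→≡)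
open import Relation.Nullary using (¬?; yes; no)
open import Relation.Nullary.Decidable using (decidable-stable)
open import Relation.Binary.PropositionalEquality
open import Function using (_∘_)

open import Algebra.Properties.Semiring.Sum (CommutativeRing.semiring ℚP.+-*-commutativeRing)
  using (sum-syntax; sum-cong-≗; sum-replicate-zero; sum-remove)
open +-*-Solver using (solve; con; _:+_; _:*_; _:-_; :-_; _:=_)
open ≡-Reasoning

∑-sub-* : ∀ {m} (f g : Fin m → ℚ) y →
  ∑[ i < m ] (f i - g i * y) ≡ (∑[ i < m ] f i) - (∑[ i < m ] g i) * y
∑-sub-* {zero} f g y = solve 1 (λ y → con 0ℚ := con 0ℚ :- con 0ℚ :* y) refl y
∑-sub-* {suc m} f g y = begin
  (f₀ - g₀ * y) + ∑[ i < m ] (f (Fin.suc i) - g (Fin.suc i) * y)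
    ≡⟨ cong ((f₀ - g₀ * y) +_) (∑-sub-* (f ∘ Fin.suc) (g ∘ Fin.suc) y) ⟩
  (f₀ - g₀ * y) + (F - G * y)
    ≡⟨ solve 5 (λ a b c d y → (a :- b :* y) :+ (c :- d :* y) := (a :+ c) :- (b :+ d) :* y)
             refl f₀ g₀ F G y ⟩
  (f₀ + F) - (g₀ + G) * y ∎
  where
  f₀ = f Fin.zero
  g₀ = g Fin.zero
  F = ∑[ i < m ] f (Fin.suc i)
  G = ∑[ i < m ] g (Fin.suc i)

Independent : ∀ {m k} → (Fin m → Fin k → ℚ) → Set
Independent {m} {k} v =
  ∀ (c : Fin m → ℚ) → (∀ j → ∑[ i < m ] (c i * v i j) ≡ 0ℚ) → ∀ i → c i ≡ 0ℚ

independent-dropZeroColumn : ∀ {m k} {v : Fin m → Fin (suc k) → ℚ} →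
  (∀ i → v i Fin.zero ≡ 0ℚ) → Independent v → Independent (λ i j → v i (Fin.suc j))
independent-dropZeroColumn {m} {v = v} v₀≡0 ind c rel = ind c rel′
  where
  rel′ : ∀ j → ∑[ i < m ] (c i * v i j) ≡ 0ℚ
  rel′ Fin.zero = trans (sum-cong-≗ (λ i → trans (cong (c i *_) (v₀≡0 i)) (ℚP.*-zeroʳ (c i))))
                        (sum-replicate-zero m)
  rel′ (Fin.suc j) = rel j

-- Removing the vector p and subtracting multiples of it from the others preserves
-- independence: a relation c among the new vectors is the relation
-- insertAt c p (- ∑ c i r i) among the old ones.
independent-shear : ∀ {m k} {v : Fin (suc m) → Fin k → ℚ} (p : Fin (suc m)) (r : Fin m → ℚ) →
  Independent v → Independent (λ i j → v (punchIn p i) j - r i * v p j)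
independent-shear {m} {v = v} p r ind c rel i =
  trans (sym (insertAt-punchIn c p t i)) (ind c′ rel′ (punchIn p i))
  where
  t = - ∑[ i < m ] (c i * r i)
  c′ = insertAt c p t
  rel′ : ∀ j → ∑[ i < suc m ] (c′ i * v i j) ≡ 0ℚ
  rel′ j = begin
    ∑[ i < suc m ] (c′ i * v i j)
      ≡⟨ sum-remove (λ i → c′ i * v i j) ⟩
    c′ p * v p j + ∑[ i < m ] (c′ (punchIn p i) * v (punchIn p i) j)
      ≡⟨ cong₂ (λ a s → a * v p j + s) (insertAt-lookup c p t)
               (sum-cong-≗ (λ i → cong (_* v (punchIn p i) j) (insertAt-punchIn c p t i))) ⟩
    t * v p j + X
      ≡⟨ solve 3 (λ R y X → (:- R) :* y :+ X := X :- R :* y) refl (∑[ i < m ] (c i * r i)) (v p j) X ⟩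
    X - (∑[ i < m ] (c i * r i)) * v p j
      ≡⟨ sym (∑-sub-* (λ i → c i * v (punchIn p i) j) (λ i → c i * r i) (v p j)) ⟩
    ∑[ i < m ] (c i * v (punchIn p i) j - c i * r i * v p j)
      ≡⟨ sum-cong-≗ (λ i → solve 4 (λ c x r y → c :* (x :- r :* y) := c :* x :- c :* r :* y)
                                   refl (c i) (v (punchIn p i) j) (r i) (v p j)) ⟨
    ∑[ i < m ] (c i * (v (punchIn p i) j - r i * v p j))
      ≡⟨ rel j ⟩
    0ℚ ∎
    where X = ∑[ i < m ] (c i * v (punchIn p i) j)

p-p*1/q*q≡0 : ∀ x a .{{_ : ℚ.NonZero a}} → x - x * 1/ a * a ≡ 0ℚ
p-p*1/q*q≡0 x a = begin
  x - x * 1/ a * a     ≡⟨ cong (λ z → x - z) (ℚP.*-assoc x (1/ a) a) ⟩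
  x - x * (1/ a * a)   ≡⟨ cong (λ z → x - x * z) (ℚP.*-inverseˡ a) ⟩
  x - x * 1ℚ           ≡⟨ cong (λ z → x - z) (ℚP.*-identityʳ x) ⟩
  x - x                ≡⟨ ℚP.+-inverseʳ x ⟩
  0ℚ                   ∎

-- Gaussian elimination on the first coordinate.
independent⇒≤ : ∀ {m k} (v : Fin m → Fin k → ℚ) → Independent v → m ℕ.≤ k
independent⇒≤ {zero} v ind = z≤n
independent⇒≤ {suc m} {zero} v ind with () ← ind (λ _ → 1ℚ) (λ ()) Fin.zero
independent⇒≤ {suc m} {suc k} v ind with FinP.any? (λ i → ¬? (v i Fin.zero ℚ.≟ 0ℚ))
... | no noPivot =
  ℕP.m≤n⇒m≤1+n (independent⇒≤ (λ i j → v i (Fin.suc j)) (independent-dropZeroColumn {v = v} v₀≡0 ind))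
  where
  v₀≡0 : ∀ i → v i Fin.zero ≡ 0ℚ
  v₀≡0 i = decidable-stable (v i Fin.zero ℚ.≟ 0ℚ) (λ ≢0 → noPivot (i , ≢0))
... | yes (p , a≢0) =
  s≤s (independent⇒≤ (λ i j → v′ i (Fin.suc j))
         (independent-dropZeroColumn {v = v′} v′₀≡0 (independent-shear {v = v} p r ind)))
  where
  instance _ = ℚ.≢-nonZero a≢0
  a = v p Fin.zero
  r : Fin m → ℚ
  r i = v (punchIn p i) Fin.zero * 1/ a
  v′ : Fin m → Fin (suc k) → ℚ
  v′ i j = v (punchIn p i) j - r i * v p j
  v′₀≡0 : ∀ i → v (punchIn p i) Fin.zero - r i * a ≡ 0ℚ
  v′₀≡0 i = p-p*1/q*q≡0 (v (punchIn p i) Fin.zero) a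

lookup-lincomb : ∀ {k} (vs : List (Vecℚ k)) (c : Fin (length vs) → ℚ) (j : Fin k) →
  lookup (lincomb vs (tabulate c)) j ≡ ∑[ i < length vs ] (c i * lookup (List.lookup vs i) j)
lookup-lincomb List.[] c j = VecP.lookup-replicate j 0ℚ
lookup-lincomb (v List.∷ vs) c j = begin
  lookup ((c Fin.zero ·V v) +V lincomb vs (tabulate (c ∘ Fin.suc))) j
    ≡⟨ VecP.lookup-zipWith _+_ j (c Fin.zero ·V v) _ ⟩
  lookup (c Fin.zero ·V v) j + lookup (lincomb vs (tabulate (c ∘ Fin.suc))) j
    ≡⟨ cong₂ _+_ (VecP.lookup-map j (c Fin.zero *_) v) (lookup-lincomb vs (c ∘ Fin.suc) j) ⟩
  c Fin.zero * lookup v j + ∑[ i < length vs ] (c (Fin.suc i) * lookup (List.lookup vs i) j) ∎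

linIndep⇒independent : ∀ {k} (vs : List (Vecℚ k)) → LinIndep vs →
  Independent (λ i j → lookup (List.lookup vs i) j)
linIndep⇒independent vs li c rel i = begin
  c i                              ≡⟨ VecP.lookup∘tabulate c i ⟨
  lookup (tabulate c) i            ≡⟨ cong (λ z → lookup z i) (li (tabulate c) lincomb≡0) ⟩
  lookup (Vec.replicate _ 0ℚ) i    ≡⟨ VecP.lookup-replicate i 0ℚ ⟩
  0ℚ                               ∎
  where
  lincomb≡0 : lincomb vs (tabulate c) ≡ zeroV
  lincomb≡0 = begin
    lincomb vs (tabulate c)             ≡⟨ VecP.tabulate∘lookup _ ⟨
    tabulate (lookup (lincomb vs (tabulate c)))
      ≡⟨ VecP.tabulate-cong (λ j → trans (lookup-lincomb vs c j)
                                   (trans (rel j) (sym (VecP.lookup-replicate j 0ℚ)))) ⟩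
    tabulate (lookup zeroV)             ≡⟨ VecP.tabulate∘lookup zeroV ⟩
    zeroV                               ∎

linIndep⇒length≤ : ∀ {k} (vs : List (Vecℚ k)) → LinIndep vs → length vs ℕ.≤ k
linIndep⇒length≤ vs li = independent⇒≤ _ (linIndep⇒independent vs li)

-- Mixed-radix enumeration of the submonomials of e.
cone : ∀ {n} (e : Monomial n) → Fin (coneSize e) → Monomial n
cone [] _ = []
cone (a ∷ e) t = toℕ (proj₁ split) ∷ cone e (proj₂ split)
  where split = remQuot {suc a} (coneSize e) t

cone-≼ : ∀ {n} (e : Monomial n) t → cone e t ≼ e
cone-≼ [] t = []
cone-≼ (a ∷ e) t = ℕP.≤-pred (FinP.toℕ<n (proj₁ split)) ∷ cone-≼ e (proj₂ split)
  where split = remQuot {suc a} (coneSize e) t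

cone-injective : ∀ {n} (e : Monomial n) {t t′} → cone e t ≡ cone e t′ → t ≡ t′
cone-injective [] {Fin.zero} {Fin.zero} _ = refl
cone-injective (a ∷ e) {t} {t′} eq = begin
  t                                       ≡⟨ FinP.combine-remQuot {suc a} (coneSize e) t ⟨
  combine (proj₁ (split t)) (proj₂ (split t))
    ≡⟨ cong (λ q → combine (proj₁ q) (proj₂ q))
            (×-≡,≡→≡ (FinP.toℕ-injective (VecP.∷-injectiveˡ eq) , cone-injective e (VecP.∷-injectiveʳ eq))) ⟩
  combine (proj₁ (split t′)) (proj₂ (split t′))
                                          ≡⟨ FinP.combine-remQuot {suc a} (coneSize e) t′ ⟩
  t′                                      ∎
  where split = remQuot {suc a} (coneSize e)

coneSize≤length : ∀ {n} {S : List (Monomial n)} → ConeClosed S → ∀ {e} → e ∈ S →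
  coneSize e ℕ.≤ length S
coneSize≤length {S = S} closed {e} e∈S = FinP.injective⇒≤ {f = position} position-injective
  where
  cone∈S : ∀ t → cone e t ∈ S
  cone∈S t = closed e (cone e t) e∈S (cone-≼ e t)
  position : Fin (coneSize e) → Fin (length S)
  position t = Any.index (cone∈S t)
  position-injective : ∀ {t t′} → position t ≡ position t′ → t ≡ t′
  position-injective {t} {t′} eq = cone-injective e
    (trans (lookup-index (cone∈S t)) (trans (cong (List.lookup S) eq) (sym (lookup-index (cone∈S t′)))))

coneSize-positive : ∀ {n} (e : Monomial n) → 1 ℕ.≤ coneSize e
coneSize-positive [] = s≤s z≤n
coneSize-positive (a ∷ e) = ℕP.≤-trans (coneSize-positive e) (ℕP.m≤m+n (coneSize e) _)

2^supportSize≤coneSize : ∀ {n} (e : Monomial n) → 2 ℕ.^ supportSize e ℕ.≤ coneSize e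
2^supportSize≤coneSize [] = s≤s z≤n
2^supportSize≤coneSize (zero ∷ e) = ℕP.m≤n⇒m≤n+o 0 (2^supportSize≤coneSize e)
2^supportSize≤coneSize (suc a ∷ e) =
  ℕP.*-mono-≤ {2} {suc (suc a)} (s≤s (s≤s z≤n)) (2^supportSize≤coneSize e)

coneSize≤⇒2^supportSize< : ∀ {n} (e : Monomial n) {k} → coneSize e ℕ.≤ k →
  2 ℕ.^ supportSize e ℕ.< 2 ℕ.* k
coneSize≤⇒2^supportSize< e {k} cone≤k = ℕP.≤-<-trans
  (ℕP.≤-trans (2^supportSize≤coneSize e) cone≤k)
  (ℕP.m<m+n k (ℕP.≤-trans (coneSize-positive e) (ℕP.≤-trans cone≤k (ℕP.m≤m+n k 0))))

lemma23 : (n k : ℕ) (D : Poly n k) → HasConeClosedBasis D →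
    ConeConcentrated (suc k) D × LgSupportConcentrated D
lemma23 n k D (S , closed , indep , spans) =
  (λ v v∈lrsp → S , All.tabulate (λ e∈S → s≤s (coneSize≤k e∈S)) , spans v v∈lrsp) ,
  (λ v v∈lrsp → S , All.tabulate (λ {e} e∈S → coneSize≤⇒2^supportSize< e (coneSize≤k e∈S)) ,
                 spans v v∈lrsp)
  where
  length≤k : length S ℕ.≤ k
  length≤k = subst (ℕ._≤ k) (ListP.length-map (coef D) S) (linIndep⇒length≤ (coefs D S) indep)
  coneSize≤k : ∀ {e} → e ∈ S → coneSize e ℕ.≤ k
  coneSize≤k e∈S = ℕP.≤-trans (coneSize≤length closed e∈S) length≤k
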